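{- Let $p$ be a finite binary word of length $m$ with $p[1]=1$, and let $k$ be the number of runs in $p$. Then $p$ can be transformed into the word $0^m$ by successively applying $k$ masque operations of type $A$ of length $m$, and no sequence of fewer than $k$ masque operations of type $A$ of length $m$ transforms $p$ into $0^m$.
   Context: A run in a word is a maximal block of equal consecutive letters. For $0\le t\le m$, the masque of type $A$ of length $m$ is $M^A_m(t)=0^t1^{m-t}$; the associated masque operation maps $q\in\{0,1\}^m$ to the word whose $i$-th letter is $q[i]$ if $M^A_m(t)[i]=0$ and $1-q[i]$ if $M^A_m(t)[i]=1$ (it complements positions $t+1,\dots,m$). -}

module Defs where

open import Data.Bool using (Bool; true; false; not; if_then_else_; _xor_)
open import Data.Nat using (ℕ; zero; suc; _+_; _<ᵇ_)
open import Data.Fin using (Fin; toℕ)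
open import Data.Vec using (Vec; []; _∷_; lookup; tabulate)
open import Data.List using (List; foldl)

-- Letters: false = 0, true = 1.  Words of length m: Vec Bool m.

-- Masque of type A of length m with parameter t (0 ≤ t ≤ m):
-- M^A_m(t) = 0^t 1^(m-t); letter at 0-based index i is 1 iff i ≥ t.
masqueA : (m : ℕ) → Fin (suc m) → Vec Bool m
masqueA m t = tabulate (λ i → if toℕ i <ᵇ toℕ t then false else true)

applyMasqueA : {m : ℕ} → Fin (suc m) → Vec Bool m → Vec Bool m
applyMasqueA {m} t q = tabulate (λ i → if lookup (masqueA m t) i then not (lookup q i) else lookup q i)

applySeq : {m : ℕ} → List (Fin (suc m)) → Vec Bool m → Vec Bool m
applySeq ts q = foldl (λ w t → applyMasqueA t w) q ts

runsFrom : {m : ℕ} → Bool → Vec Bool m → ℕ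
runsFrom b [] = 0
runsFrom b (x ∷ xs) = if x xor b then suc (runsFrom x xs) else runsFrom x xs

runs : {m : ℕ} → Vec Bool m → ℕ
runs [] = 0
runs (x ∷ xs) = suc (runsFrom x xs)

module Submission where

open import Defs
open import Data.Bool using (Bool; true; false; not; _xor_)
open import Data.Bool.Properties using (xor-same)
open import Data.Nat using (ℕ; zero; suc; _+_; _≤_; z≤n; s≤s)
open import Data.Nat.Properties using (≤-refl; ≤-trans; n≤1+n; m≤n⇒m≤1+n; +-identityʳ; module ≤-Reasoning)
open import Data.Vec using (Vec; []; _∷_; head; replicate; map)
open import Data.Vec.Properties using (map-replicate)
open import Data.List using (List; length; []; _∷_; _∷ʳ_) renaming (map to mapᴸ)
open import Data.List.Properties using (length-map; foldl-∷ʳ)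
open import Data.Fin using (Fin; zero; suc)
open import Data.Product using (Σ; _×_; _,_)
open import Relation.Binary.PropositionalEquality using (_≡_; refl; cong; trans; module ≡-Reasoning)

-- runsFrom c q counts the letter changes in the word c q, i.e. the runs of q
-- not counting a leading run of c's; so runs (true ∷ xs) = runsFrom false (true ∷ xs).
-- The masque with parameter t complements the suffix after position t, which preserves
-- every letter change except the one between positions t and t + 1 (with a virtual
-- leading c at position 0); hence one operation removes at most one run, giving the
-- lower bound.  Conversely, q reaches c^m by first making its tail constant equal to
-- its head x (operations shifted one position to the right) and then, if x ≠ c,
-- complementing the whole word once; this uses exactly runsFrom c q operations.

private
  variable
    m : ℕ

applyMasqueA-zero : (q : Vec Bool m) → applyMasqueA zero q ≡ map not q
applyMasqueA-zero [] = refl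
applyMasqueA-zero (x ∷ xs) = cong (not x ∷_) (applyMasqueA-zero xs)

applySeq-map-suc : (ts : List (Fin (suc m))) (x : Bool) (xs : Vec Bool m) →
                   applySeq (mapᴸ suc ts) (x ∷ xs) ≡ x ∷ applySeq ts xs
applySeq-map-suc [] x xs = refl
applySeq-map-suc (t ∷ ts) x xs = applySeq-map-suc ts x (applyMasqueA t xs)

runsFrom-map-not : (c : Bool) (q : Vec Bool m) → runsFrom c (map not q) ≡ runsFrom (not c) q
runsFrom-map-not c [] = refl
runsFrom-map-not false (false ∷ xs) = cong suc (runsFrom-map-not true xs)
runsFrom-map-not false (true ∷ xs) = runsFrom-map-not false xs
runsFrom-map-not true (false ∷ xs) = runsFrom-map-not true xs
runsFrom-map-not true (true ∷ xs) = cong suc (runsFrom-map-not false xs)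

runsFrom-≤-suc-runsFrom-not : (c : Bool) (q : Vec Bool m) → runsFrom c q ≤ suc (runsFrom (not c) q)
runsFrom-≤-suc-runsFrom-not c [] = z≤n
runsFrom-≤-suc-runsFrom-not false (false ∷ xs) = m≤n⇒m≤1+n (n≤1+n _)
runsFrom-≤-suc-runsFrom-not false (true ∷ xs) = ≤-refl
runsFrom-≤-suc-runsFrom-not true (false ∷ xs) = ≤-refl
runsFrom-≤-suc-runsFrom-not true (true ∷ xs) = m≤n⇒m≤1+n (n≤1+n _)

runsFrom-replicate : (c : Bool) (m : ℕ) → runsFrom c (replicate m c) ≡ 0
runsFrom-replicate c zero = refl
runsFrom-replicate c (suc m) rewrite xor-same c = runsFrom-replicate c m

runsFrom-≤-suc-runsFrom-applyMasqueA : (c : Bool) (t : Fin (suc m)) (q : Vec Bool m) →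
                                       runsFrom c q ≤ suc (runsFrom c (applyMasqueA t q))
runsFrom-≤-suc-runsFrom-applyMasqueA c zero q = begin
  runsFrom c q                              ≤⟨ runsFrom-≤-suc-runsFrom-not c q ⟩
  suc (runsFrom (not c) q)                  ≡⟨ cong suc (runsFrom-map-not c q) ⟨
  suc (runsFrom c (map not q))              ≡⟨ cong (λ w → suc (runsFrom c w)) (applyMasqueA-zero q) ⟨
  suc (runsFrom c (applyMasqueA zero q))    ∎
  where open ≤-Reasoning
runsFrom-≤-suc-runsFrom-applyMasqueA c (suc t) (x ∷ xs) with x xor c
... | false = runsFrom-≤-suc-runsFrom-applyMasqueA x t xs
... | true = s≤s (runsFrom-≤-suc-runsFrom-applyMasqueA x t xs)

runsFrom-≤-length+runsFrom-applySeq : (c : Bool) (ts : List (Fin (suc m))) (q : Vec Bool m) →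
                                      runsFrom c q ≤ length ts + runsFrom c (applySeq ts q)
runsFrom-≤-length+runsFrom-applySeq c [] q = ≤-refl
runsFrom-≤-length+runsFrom-applySeq c (t ∷ ts) q =
  ≤-trans (runsFrom-≤-suc-runsFrom-applyMasqueA c t q)
          (s≤s (runsFrom-≤-length+runsFrom-applySeq c ts (applyMasqueA t q)))

runsFrom-≤-length : (c : Bool) (ts : List (Fin (suc m))) (q : Vec Bool m) →
                    applySeq ts q ≡ replicate m c → runsFrom c q ≤ length ts
runsFrom-≤-length {m} c ts q reaches = begin
  runsFrom c q                                 ≤⟨ runsFrom-≤-length+runsFrom-applySeq c ts q ⟩
  length ts + runsFrom c (applySeq ts q)       ≡⟨ cong (λ w → length ts + runsFrom c w) reaches ⟩
  length ts + runsFrom c (replicate m c)       ≡⟨ cong (length ts +_) (runsFrom-replicate c m) ⟩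
  length ts + 0                                ≡⟨ +-identityʳ (length ts) ⟩
  length ts                                    ∎
  where open ≤-Reasoning

length-∷ʳ : {A : Set} (xs : List A) (y : A) → length (xs ∷ʳ y) ≡ suc (length xs)
length-∷ʳ [] y = refl
length-∷ʳ (x ∷ xs) y = cong suc (length-∷ʳ xs y)

Reaches : Vec Bool m → Bool → ℕ → Set
Reaches {m} q c k = Σ (List (Fin (suc m))) (λ ts → (length ts ≡ k) × (applySeq ts q ≡ replicate m c))

reaches-∷ : {x : Bool} {xs : Vec Bool m} {k : ℕ} → Reaches xs x k → Reaches (x ∷ xs) x k
reaches-∷ {x = x} {xs} (ts , len , reaches) =
  mapᴸ suc ts , trans (length-map suc ts) len , trans (applySeq-map-suc ts x xs) (cong (x ∷_) reaches)

reaches-∷-complement : {x : Bool} {xs : Vec Bool m} {k : ℕ} → Reaches xs x k → Reaches (x ∷ xs) (not x) (suc k)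
reaches-∷-complement {m} {x} {xs} r with reaches-∷ r
... | tsˢ , lenˢ , reachesˢ = tsˢ ∷ʳ zero , trans (length-∷ʳ tsˢ zero) (cong suc lenˢ) , complemented
  where
  open ≡-Reasoning
  complemented : applySeq (tsˢ ∷ʳ zero) (x ∷ xs) ≡ replicate (suc m) (not x)
  complemented = begin
    applySeq (tsˢ ∷ʳ zero) (x ∷ xs)               ≡⟨ foldl-∷ʳ _ (x ∷ xs) zero tsˢ ⟩
    applyMasqueA zero (applySeq tsˢ (x ∷ xs))     ≡⟨ cong (applyMasqueA zero) reachesˢ ⟩
    applyMasqueA zero (replicate (suc m) x)       ≡⟨ applyMasqueA-zero (replicate (suc m) x) ⟩
    map not (replicate (suc m) x)                 ≡⟨ map-replicate not x (suc m) ⟩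
    replicate (suc m) (not x)                     ∎

reaches-runsFrom : (c : Bool) (q : Vec Bool m) → Reaches q c (runsFrom c q)
reaches-runsFrom c [] = [] , refl , refl
reaches-runsFrom c (x ∷ xs) with reaches-runsFrom x xs
... | r with x | c
... | false | false = reaches-∷ r
... | true  | true  = reaches-∷ r
... | false | true  = reaches-∷-complement r
... | true  | false = reaches-∷-complement r

proposition1 : (n : ℕ) → (p : Vec Bool (suc n)) → head p ≡ true
    → Σ (List (Fin (suc (suc n)))) (λ ts → (length ts ≡ runs p) × (applySeq ts p ≡ replicate (suc n) false))
      × ((ts : List (Fin (suc (suc n)))) → applySeq ts p ≡ replicate (suc n) false → runs p ≤ length ts)
proposition1 n (true ∷ xs) refl =
  reaches-runsFrom false (true ∷ xs) , λ ts → runsFrom-≤-length false ts (true ∷ xs)
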